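{- There exists a functional $\varepsilon \colon 2^{(2^{\mathbb{N}})} \to 2^{\mathbb{N}}$ which is definable in System $T$ (i.e. is the denotation, in the set-theoretical model, of a closed System $T$ term of type $((\mathbb{N}\to\mathrm{Bool})\to\mathrm{Bool})\to(\mathbb{N}\to\mathrm{Bool})$) such that for every function $p \colon 2^{\mathbb{N}} \to 2$ (not necessarily continuous or definable): (i) if $p(\bar{n}) = 1$ for some $n \in \mathbb{N}$, then $\varepsilon(p) = \bar{m}$ where $m$ is the least $n\in\mathbb{N}$ with $p(\bar{n})=1$; and if there is no $n \in \mathbb{N}$ with $p(\bar{n})=1$, then $\varepsilon(p)=\infty$. Equivalently, $\varepsilon(p) = \inf\{x \in \mathbb{N}_\infty \mid p(x) = 1\}$ with respect to the pointwise order on $\mathbb{N}_\infty$ (the infimum of the empty set being the top element $\infty$); (ii) the image of $\varepsilon$ is exactly $\mathbb{N}_\infty$; (iii) $p(\varepsilon(p)) = 1$ if and only if $p(x) = 1$ for some $x \in \mathbb{N}_\infty$. Concretely, one may take $\varepsilon(p)(i) = 1$ iff $p(\bar{n}) = 1$ for some $n \le i$.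
   Context: System $T$ is the simply typed lambda-calculus with a base type of natural numbers (with zero, successor and primitive recursion at all higher types) and a base type $\mathrm{Bool}$ of booleans (with true, false and if-then-else). Its set-theoretical model interprets the natural numbers type as $\mathbb{N}$, the boolean type as $2 = \{0,1\}$ (with $0$ = false, $1$ = true), and function types as the sets of all functions; an element of the interpretation of a type is called $T$-definable if it is the interpretation of some closed term of that type. Write $2^{\mathbb{N}}$ for the set of all functions $\mathbb{N}\to 2$ (infinite binary sequences). Define $\mathbb{N}_\infty = \{x \in 2^{\mathbb{N}} \mid \forall i \le j.\ x_i \le x_j\}$, ordered pointwise. For $n \in \mathbb{N}$ write $\bar{n} = 0^n 1^\omega$ (the sequence with $\bar{n}_i = 0$ for $i<n$ and $1$ for $i \ge n$), and write $\infty = 0^\omega$ (the constantly $0$ sequence). Classically, $\mathbb{N}_\infty = \{\bar{n} \mid n\in\mathbb{N}\}\cup\{\infty\}$, and $\infty$ is the top element of $\mathbb{N}_\infty$ in the pointwise order. -}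

module Defs where

open import Data.Nat.Base using (ℕ; zero; suc; _<_; _≤_; _<ᵇ_)
open import Data.Bool.Base using (Bool; true; false; not; if_then_else_)
import Data.Bool.Base as B
open import Data.List.Base using (List; []; _∷_)
open import Data.Product.Base using (Σ; _×_; _,_)
open import Relation.Binary.PropositionalEquality using (_≡_)

infixr 20 _⇒_
data Ty : Set where
  nat  : Ty
  bool : Ty
  _⇒_  : Ty → Ty → Ty

Ctx : Set
Ctx = List Ty

data Var : Ctx → Ty → Set where
  here  : ∀ {Γ σ} → Var (σ ∷ Γ) σ
  there : ∀ {Γ σ τ} → Var Γ σ → Var (τ ∷ Γ) σ

data Tm (Γ : Ctx) : Ty → Set where
  var   : ∀ {σ} → Var Γ σ → Tm Γ σ
  lam   : ∀ {σ τ} → Tm (σ ∷ Γ) τ → Tm Γ (σ ⇒ τ)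
  app   : ∀ {σ τ} → Tm Γ (σ ⇒ τ) → Tm Γ σ → Tm Γ τ
  zero  : Tm Γ nat
  succ  : Tm Γ (nat ⇒ nat)
  rec   : ∀ {σ} → Tm Γ (σ ⇒ (nat ⇒ σ ⇒ σ) ⇒ nat ⇒ σ)
  tt    : Tm Γ bool
  ff    : Tm Γ bool
  ite   : ∀ {σ} → Tm Γ (bool ⇒ σ ⇒ σ ⇒ σ)

-- Set-theoretical model (Bool: false = 0, true = 1)

⟦_⟧ty : Ty → Set
⟦ nat ⟧ty   = ℕ
⟦ bool ⟧ty  = Bool
⟦ σ ⇒ τ ⟧ty = ⟦ σ ⟧ty → ⟦ τ ⟧ty

data Env : Ctx → Set where
  []  : Env []
  _∷_ : ∀ {σ Γ} → ⟦ σ ⟧ty → Env Γ → Env (σ ∷ Γ)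

lookupEnv : ∀ {Γ σ} → Env Γ → Var Γ σ → ⟦ σ ⟧ty
lookupEnv (v ∷ ρ) here      = v
lookupEnv (v ∷ ρ) (there x) = lookupEnv ρ x

primRec : ∀ {A : Set} → A → (ℕ → A → A) → ℕ → A
primRec z s zero    = z
primRec z s (suc n) = s n (primRec z s n)

⟦_⟧tm : ∀ {Γ σ} → Tm Γ σ → Env Γ → ⟦ σ ⟧ty
⟦ var x ⟧tm ρ   = lookupEnv ρ x
⟦ lam t ⟧tm ρ   = λ v → ⟦ t ⟧tm (v ∷ ρ)
⟦ app t u ⟧tm ρ = ⟦ t ⟧tm ρ (⟦ u ⟧tm ρ)
⟦ zero ⟧tm ρ    = 0
⟦ succ ⟧tm ρ    = suc
⟦ rec ⟧tm ρ     = primRec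
⟦ tt ⟧tm ρ      = true
⟦ ff ⟧tm ρ      = false
⟦ ite ⟧tm ρ     = λ b x y → if b then x else y

⟦_⟧ : ∀ {σ} → Tm [] σ → ⟦ σ ⟧ty
⟦ t ⟧ = ⟦ t ⟧tm []

TDefinable : (σ : Ty) → ⟦ σ ⟧ty → Set
TDefinable σ x = Σ (Tm [] σ) λ t → ⟦ t ⟧ ≡ x

Cantor : Set
Cantor = ℕ → Bool

Inℕ∞ : Cantor → Set
Inℕ∞ x = ∀ i j → i ≤ j → x i B.≤ x j

-- n̄ = 0^n 1^ω
bar : ℕ → Cantor
bar n i = not (i <ᵇ n)

∞ : Cantor
∞ _ = false

-- ε p i = 1 iff p(n̄) = 1 for some n ≤ i: a bounded search, hence primitive
-- recursive in p. So ε p is the running disjunction of the sequence n ↦ p(n̄),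
-- which is 0 before the least n with p(n̄) = 1 and 1 from there on, i.e. it is
-- that n̄, or ∞ if there is no such n. A monotone sequence is its own running
-- disjunction, so every x ∈ ℕ∞ is ε p for any p with p(n̄) = x n; classically
-- it is also some n̄ or ∞, which gives (iii): if p holds at some n̄ it holds at
-- the least one, which is ε p, and otherwise it can only hold at ∞ = ε p.
module Submission where

open import Defs
open import Level using (0ℓ)
open import Data.Nat.Base using (ℕ; _<_)
open import Data.Bool.Base using (Bool; true; false)
open import Data.Product.Base using (Σ; _×_; _,_)
open import Relation.Binary.PropositionalEquality using (_≡_)
open import Axiom.Extensionality.Propositional using (Extensionality)
open import Axiom.ExcludedMiddle using (ExcludedMiddle)

open import Function.Base using (_∘_)
open import Data.Nat.Base using (zero; suc; _≤_; z≤n; s≤s)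
open import Data.Nat.Properties using (≤-refl; ≤-trans; ≤-antisym; ≮⇒≥; n<1+n; n≤1+n; m≤n⇒m≤1+n; m≤n⇒m<n∨m≡n; m<1+n⇒m<n∨m≡n)
import Data.Bool.Base as Bool
open import Data.Bool.Base using (_∨_; if_then_else_)
open import Data.Bool.Properties using (∨-zeroʳ; ¬-not)
open import Data.Sum.Base using (_⊎_; inj₁; inj₂; [_,_])
open import Data.List.Base using ([])
open import Relation.Nullary.Decidable using (yes; no; does; dec-true; dec-false)
open import Relation.Nullary.Negation using (contradiction)
open import Relation.Binary.PropositionalEquality using (_≗_; refl; sym; trans; cong; cong₂; subst)

≡true-iff⇒≡ : ∀ {a b : Bool} → (a ≡ true → b ≡ true) → (b ≡ true → a ≡ true) → a ≡ b
≡true-iff⇒≡ {false} {false} _ _ = refl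
≡true-iff⇒≡ {false} {true}  _ b⇒a = b⇒a refl
≡true-iff⇒≡ {true}  {_}     a⇒b _ = sym (a⇒b refl)

≡true⇒⇒≤ : ∀ {a b : Bool} → (a ≡ true → b ≡ true) → a Bool.≤ b
≡true⇒⇒≤ {false} {false} _ = Bool.b≤b
≡true⇒⇒≤ {false} {true}  _ = Bool.f≤t
≡true⇒⇒≤ {true}  a⇒b with refl ← a⇒b refl = Bool.b≤b

≤⇒∨≡ʳ : ∀ {a b : Bool} → a Bool.≤ b → a ∨ b ≡ b
≤⇒∨≡ʳ {false} Bool.b≤b = refl
≤⇒∨≡ʳ {true}  Bool.b≤b = refl
≤⇒∨≡ʳ         Bool.f≤t = refl

if-then-true≡∨ : ∀ a b → (if a then true else b) ≡ a ∨ b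
if-then-true≡∨ false _ = refl
if-then-true≡∨ true  _ = refl

bar-≡true : ∀ {n i} → n ≤ i → bar n i ≡ true
bar-≡true {zero}          _         = refl
bar-≡true {suc n} {suc i} (s≤s n≤i) = bar-≡true n≤i

bar-≡true⇒≤ : ∀ n i → bar n i ≡ true → n ≤ i
bar-≡true⇒≤ zero    _       _ = z≤n
bar-≡true⇒≤ (suc n) (suc i) e = s≤s (bar-≡true⇒≤ n i e)

bar-injective : ∀ {m n} → bar m ≡ bar n → m ≡ n
bar-injective {m} {n} e = ≤-antisym
  (bar-≡true⇒≤ m n (trans (cong (λ x → x n) e) (bar-≡true {n} ≤-refl)))
  (bar-≡true⇒≤ n m (trans (cong (λ x → x m) (sym e)) (bar-≡true {m} ≤-refl)))

anyUpTo : (ℕ → Bool) → Cantor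
anyUpTo f zero    = f zero
anyUpTo f (suc i) = anyUpTo f i ∨ f (suc i)

module _ {f : ℕ → Bool} where

  anyUpTo-intro : ∀ {n i} → n ≤ i → f n ≡ true → anyUpTo f i ≡ true
  anyUpTo-intro {i = zero}  z≤n fn = fn
  anyUpTo-intro {i = suc i} n≤1+i fn with m≤n⇒m<n∨m≡n n≤1+i
  ... | inj₁ (s≤s n≤i) rewrite anyUpTo-intro n≤i fn = refl
  ... | inj₂ refl      rewrite fn = ∨-zeroʳ (anyUpTo f i)

  anyUpTo-elim : ∀ i → anyUpTo f i ≡ true → Σ ℕ λ n → n ≤ i × f n ≡ true
  anyUpTo-elim zero    e = zero , z≤n , e
  anyUpTo-elim (suc i) e with anyUpTo f i in found
  ... | true  = let n , n≤i , fn = anyUpTo-elim i found in n , m≤n⇒m≤1+n n≤i , fn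
  ... | false = suc i , ≤-refl , e

  anyUpTo-monotone : Inℕ∞ (anyUpTo f)
  anyUpTo-monotone i j i≤j = ≡true⇒⇒≤ λ e →
    let n , n≤i , fn = anyUpTo-elim i e in anyUpTo-intro (≤-trans n≤i i≤j) fn

Least : (ℕ → Bool) → ℕ → Set
Least f m = f m ≡ true × (∀ k → k < m → f k ≡ false)

anyUpTo-least : ∀ {f m} → Least f m → anyUpTo f ≗ bar m
anyUpTo-least {f} {m} (fm , below) i = ≡true-iff⇒≡
  (λ e → let n , n≤i , fn = anyUpTo-elim i e in bar-≡true (≤-trans (m≤ fn) n≤i))
  (λ e → anyUpTo-intro (bar-≡true⇒≤ m i e) fm)
  where
  m≤ : ∀ {n} → f n ≡ true → m ≤ n
  m≤ {n} fn = ≮⇒≥ λ n<m → contradiction (trans (sym fn) (below n n<m)) λ ()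

anyUpTo-none : ∀ {f} → (∀ n → f n ≡ false) → anyUpTo f ≗ ∞
anyUpTo-none none zero    = none zero
anyUpTo-none none (suc i) rewrite anyUpTo-none none i = none (suc i)

anyUpTo-fixes-ℕ∞ : ∀ {x} → Inℕ∞ x → anyUpTo x ≗ x
anyUpTo-fixes-ℕ∞ mono zero    = refl
anyUpTo-fixes-ℕ∞ mono (suc i) rewrite anyUpTo-fixes-ℕ∞ mono i =
  ≤⇒∨≡ʳ (mono i (suc i) (n≤1+n i))

least-or-none-below : ∀ f n → (Σ ℕ (Least f)) ⊎ (∀ k → k < n → f k ≡ false)
least-or-none-below f zero = inj₂ λ _ ()
least-or-none-below f (suc n) with least-or-none-below f n | f n in fn
... | inj₁ least | _     = inj₁ least
... | inj₂ below | true  = inj₁ (n , fn , below)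
... | inj₂ below | false = inj₂ λ k k<1+n →
  [ below k , (λ { refl → fn }) ] (m<1+n⇒m<n∨m≡n k<1+n)

least-or-none : ExcludedMiddle 0ℓ → ∀ f → (Σ ℕ (Least f)) ⊎ (∀ n → f n ≡ false)
least-or-none lem f with lem {Σ ℕ λ n → f n ≡ true}
... | no  ¬witness = inj₂ λ n → ¬-not λ fn → ¬witness (n , fn)
... | yes (n , fn) with least-or-none-below f (suc n)
...   | inj₁ least = inj₁ least
...   | inj₂ below = contradiction (trans (sym fn) (below n (n<1+n n))) λ ()

ℕ∞-classification : ExcludedMiddle 0ℓ → ∀ {x} → Inℕ∞ x → x ≗ ∞ ⊎ Σ ℕ λ m → x ≗ bar m
ℕ∞-classification lem {x} mono with least-or-none lem x
... | inj₁ (m , least) = inj₂ (m , λ i → trans (sym (anyUpTo-fixes-ℕ∞ mono i)) (anyUpTo-least least i))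
... | inj₂ none        = inj₁ none

private
  infixl 5 _·_
  _·_ : ∀ {Γ σ τ} → Tm Γ (σ ⇒ τ) → Tm Γ σ → Tm Γ τ
  _·_ = app

  pattern v₀ = var here
  pattern v₁ = var (there here)
  pattern v₃ = var (there (there (there here)))

-- bar 0 = λ i. tt,  bar (n+1) 0 = ff,  bar (n+1) (i+1) = bar n i
barT : ∀ {Γ} → Tm Γ (nat ⇒ nat ⇒ bool)
barT = lam (rec · lam tt · lam (lam (lam (rec · ff · lam (lam (v₃ · v₁)) · v₀))) · v₀)

-- λ p i. rec (p 0̄) (λ k found. if found then tt else p (k+1)‾) i
epsT : Tm [] (((nat ⇒ bool) ⇒ bool) ⇒ nat ⇒ bool)
epsT = lam (lam (rec · (v₁ · (barT · zero))
                     · lam (lam (ite · v₀ · tt · (v₃ · (barT · (succ · v₁)))))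
                     · v₀))

ε : (Cantor → Bool) → Cantor
ε p = anyUpTo (p ∘ bar)

barT-denotes-bar : ∀ n i → ⟦ barT ⟧ n i ≡ bar n i
barT-denotes-bar zero    _       = refl
barT-denotes-bar (suc n) zero    = refl
barT-denotes-bar (suc n) (suc i) = barT-denotes-bar n i

epsT-denotes-ε : Extensionality 0ℓ 0ℓ → ⟦ epsT ⟧ ≡ ε
epsT-denotes-ε ext = ext λ p → ext (pointwise p)
  where
  p∘barT≡p∘bar : ∀ p n → p (⟦ barT ⟧ n) ≡ p (bar n)
  p∘barT≡p∘bar p n = cong p (ext (barT-denotes-bar n))
  pointwise : ∀ p i → ⟦ epsT ⟧ p i ≡ ε p i
  pointwise p zero    = p∘barT≡p∘bar p zero
  pointwise p (suc i) = trans
    (cong₂ (λ found b → if found then true else b) (pointwise p i) (p∘barT≡p∘bar p (suc i)))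
    (if-then-true≡∨ (ε p i) (p (bar (suc i))))

module _ (ext : Extensionality 0ℓ 0ℓ) (lem : ExcludedMiddle 0ℓ) where

  ε-selects : ∀ p → (Σ Cantor λ x → Inℕ∞ x × p x ≡ true) → p (ε p) ≡ true
  ε-selects p (x , mono , px) with least-or-none lem (p ∘ bar)
  ... | inj₁ (m , least@(pm̄ , _)) =
    subst (λ y → p y ≡ true) (sym (ext (anyUpTo-least least))) pm̄
  ... | inj₂ none with ℕ∞-classification lem mono
  ...   | inj₁ x≗∞ =
    subst (λ y → p y ≡ true) (trans (ext x≗∞) (sym (ext (anyUpTo-none none)))) px
  ...   | inj₂ (m , x≗m̄) =
    contradiction (trans (sym (none m)) (subst (λ y → p y ≡ true) (ext x≗m̄) px)) λ ()

  ε-onto-ℕ∞ : ∀ {x} → Inℕ∞ x → Σ (Cantor → Bool) λ p → ε p ≡ x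
  ε-onto-ℕ∞ {x} mono = p , trans (cong anyUpTo (ext p∘bar≗x)) (ext (anyUpTo-fixes-ℕ∞ mono))
    where
    p : Cantor → Bool
    p y = does (lem {Σ ℕ λ n → y ≡ bar n × x n ≡ true})

    p∘bar≗x : p ∘ bar ≗ x
    p∘bar≗x n with x n in xn
    ... | true  = dec-true lem (n , refl , xn)
    ... | false = dec-false lem λ (m , n̄≡m̄ , xm) →
      contradiction (trans (sym xn) (subst (λ k → x k ≡ true) (sym (bar-injective n̄≡m̄)) xm)) λ ()

mainTheorem1 : Extensionality 0ℓ 0ℓ → ExcludedMiddle 0ℓ →
    Σ ((Cantor → Bool) → Cantor) λ ε →
      TDefinable (((nat ⇒ bool) ⇒ bool) ⇒ (nat ⇒ bool)) ε ×
      ((p : Cantor → Bool) →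
        ((∀ n → p (bar n) ≡ true → (∀ k → k < n → p (bar k) ≡ false) → ε p ≡ bar n) ×
         ((∀ n → p (bar n) ≡ false) → ε p ≡ ∞)) ×
        ((p (ε p) ≡ true → Σ Cantor λ x → Inℕ∞ x × p x ≡ true) ×
         ((Σ Cantor λ x → Inℕ∞ x × p x ≡ true) → p (ε p) ≡ true))) ×
      ((∀ p → Inℕ∞ (ε p)) ×
       (∀ x → Inℕ∞ x → Σ (Cantor → Bool) λ p → ε p ≡ x))
mainTheorem1 ext lem = ε , (epsT , epsT-denotes-ε ext) ,
  (λ p → ((λ n pn̄ below → ext (anyUpTo-least (pn̄ , below))) ,
          (λ none → ext (anyUpTo-none none))) ,
         ((λ pεp → ε p , anyUpTo-monotone , pεp) ,
          ε-selects ext lem p)) ,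
  ((λ _ → anyUpTo-monotone) ,
   (λ _ mono → ε-onto-ℕ∞ ext lem mono))
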